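{- Let $\Delta$ be the triangular bipyramid, a 2-dimensional simplicial complex on 5 vertices, consisting of two apexes each joined to all edges of a triangle (the equator). Consider three labelings: (a) apexes $1,3$ and equator $2,4,5$ (facets $124,125,145,234,235,345$); (b) apexes $1,2$ and equator $3,4,5$; (c) apexes $5,2$ and equator $3,4,1$. Then labelings (a) and (b) are perfect elimination orderings but (c) is not, while the generating function $\sum_\Upsilon t^{N-|\Upsilon_2|}$ over cage-free spanning subcomplexes $\Upsilon$ equals $(t+1)^4(t+2)$ for labelings (a) and (c) and $(t+1)^2(t+2)^2$ for labeling (b).
   Context: Let $\Delta$ be a pure simplicial complex of dimension $d\ge1$ on vertex set $[n]$. A spanning subcomplex is a subcomplex containing all faces of dimension $<d$; $\Upsilon_d$ denotes its set of $d$-dimensional faces. Write $[\sigma,i,k]_<$ for $\sigma\cup\{i,k\}$ when all vertices of $\sigma$ are less than $i<k$. A ridge $[\sigma,k]_<$ is caged in a complex if the complex contains two distinct facets $[\sigma,i,k]_<$ and $[\sigma,j,k]_<$; a spanning subcomplex is cage-free if it has no caged ridges. For a $(d-2)$-face $\sigma$ and vertex $k>\sigma$, $\Phi_{\sigma,k}=\{\phi\in\Delta_d:\phi=[\sigma,j,k]_<,\ \sigma<j<k\}$ and $N$ is the number of nonempty $\Phi_{\sigma,k}$. The labeling is a perfect elimination ordering if for all $(d-2)$-faces $\sigma$ and vertices $\sigma<i<j<k$, $[\sigma,i,k]_<,[\sigma,j,k]_<\in\Delta$ implies $[\sigma,i,j]_<\in\Delta$. -}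

module Defs where

open import Data.Nat using (ℕ; zero; suc; _+_; _*_; _∸_; _^_; _<_; _⊓_; _⊔_)
open import Data.Nat.Properties using (_≟_; _<?_)
open import Data.Nat.ListAction using (sum)
open import Data.Product using (Σ; ∃; ∃-syntax; _×_; _,_)
open import Data.List using (List; []; _∷_; _++_; map; length; filter; upTo; concatMap)
open import Data.List.Relation.Unary.Any using (Any; any?)
open import Data.List.Membership.Propositional using (_∈_; find; lose)
open import Relation.Binary.PropositionalEquality using (_≡_; _≢_; refl)
open import Relation.Nullary using (¬_; Dec; yes; no)
open import Relation.Nullary.Decidable using (_×-dec_; ¬?)

-- A 2-dimensional face (triangle) {a,b,c} is represented by the sorted
-- triple (a , b , c) with a < b < c.  A pure 2-dimensional complex is
-- given by its list of facets (all its 2-faces); its lower faces are all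
-- subsets of facets.

Tri : Set
Tri = ℕ × ℕ × ℕ

sort3 : ℕ → ℕ → ℕ → Tri
sort3 a b c = lo , (a + b + c ∸ lo ∸ hi) , hi
  where
  lo = a ⊓ b ⊓ c
  hi = a ⊔ b ⊔ c

bipyramid : ℕ → ℕ → ℕ → ℕ → ℕ → List Tri
bipyramid p q x y z =
  sort3 p x y ∷ sort3 p x z ∷ sort3 p y z ∷
  sort3 q x y ∷ sort3 q x z ∷ sort3 q y z ∷ []

-- Here d = 2, so a (d-2)-face σ is a single vertex s, and
-- [σ,i,k]_< is the triangle (s , i , k) with s < i < k.

PEO : List Tri → Set
PEO F = ∀ s i j k → s < i → i < j → j < k →
        (s , i , k) ∈ F → (s , j , k) ∈ F → (s , i , j) ∈ F

-- A spanning subcomplex Υ is determined by its set Υ_2 of 2-faces, a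
-- sublist U of the facet list.  The ridge [s,k]_< is caged in U if U
-- contains two distinct facets [s,i,k]_< and [s,j,k]_<.
Caged : List Tri → ℕ → ℕ → Set
Caged U s k = ∃[ i ] ∃[ j ] ((s , i , k) ∈ U × (s , j , k) ∈ U × i ≢ j ×
                             s < i × i < k × s < j × j < k)

CageFree : List Tri → Set
CageFree U = ∀ s k → ¬ Caged U s k

private
  Clash : Tri → Tri → Set
  Clash (a , b , c) (a' , b' , c') =
    a' ≡ a × c' ≡ c × b ≢ b' × a < b × b < c × a < b' × b' < c

  clash? : ∀ f g → Dec (Clash f g)
  clash? (a , b , c) (a' , b' , c') =
    (a' ≟ a) ×-dec (c' ≟ c) ×-dec ¬? (b ≟ b') ×-dec (a <? b) ×-dec
    (b <? c) ×-dec (a <? b') ×-dec (b' <? c)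

  Bad : List Tri → Set
  Bad U = Any (λ f → Any (Clash f) U) U

  bad? : ∀ U → Dec (Bad U)
  bad? U = any? (λ f → any? (clash? f) U) U

  bad→caged : ∀ U → Bad U → ∃[ s ] ∃[ k ] Caged U s k
  bad→caged U b with find b
  ... | (a , b₁ , c) , f∈ , any-g with find any-g
  ... | (.a , b' , .c) , g∈ , (refl , refl , ne , l1 , l2 , l3 , l4) =
        a , c , b₁ , b' , f∈ , g∈ , ne , l1 , l2 , l3 , l4

  caged→bad : ∀ U s k → Caged U s k → Bad U
  caged→bad U s k (i , j , f∈ , g∈ , ne , l1 , l2 , l3 , l4) =
    lose f∈ (lose g∈ (refl , refl , ne , l1 , l2 , l3 , l4))

cageFree? : ∀ U → Dec (CageFree U)
cageFree? U with bad? U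
... | yes b with bad→caged U b
...   | s , k , c = no (λ cf → cf s k c)
cageFree? U | no ¬b = yes (λ s k c → ¬b (caged→bad U s k c))

-- All sublists (= all subsets, as the facet lists have no repetitions).
subsets : {A : Set} → List A → List (List A)
subsets []       = [] ∷ []
subsets (x ∷ xs) = subsets xs ++ map (x ∷_) (subsets xs)

vertices : ℕ → List ℕ
vertices n = map suc (upTo n)

Φ : List Tri → ℕ → ℕ → List Tri
Φ F s k = filter (λ { (a , j , c) → (a ≟ s) ×-dec (c ≟ k) ×-dec (s <? j) ×-dec (j <? k) }) F

N : ℕ → List Tri → ℕ
N n F = length (filter (λ { (s , k) → (s <? k) ×-dec (0 <? length (Φ F s k)) })
                       (concatMap (λ s → map (s ,_) (vertices n)) (vertices n)))

genFun : ℕ → List Tri → ℕ → ℕ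
genFun n F t = sum (map (λ U → t ^ (N n F ∸ length U)) (filter cageFree? (subsets F)))

Δa Δb Δc : List Tri
Δa = bipyramid 1 3 2 4 5
Δb = bipyramid 1 2 3 4 5
Δc = bipyramid 5 2 3 4 1

-- Every claim is a finite check.  The PEO condition only concerns pairs of facets, so it
-- is decidable.  Counting the cage-free Υ by the exponent N − |Υ₂| gives the coefficient
-- lists 2, 9, 16, 14, 6, 1 for labelings (a) and (c) and 4, 12, 13, 6, 1 for (b),
-- constant term first; these are the expansions of the stated products.
module Submission where

open import Defs
open import Data.Nat using (ℕ; suc; _+_; _*_; _^_; _∸_; _<_)
open import Data.Nat.ListAction using (sum)
open import Data.Nat.Properties using (_≟_; _<?_; *-distribˡ-+; *-zeroʳ; +-commutativeSemigroup)
open import Data.Nat.Solver using (module +-*-Solver)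
open +-*-Solver using (solve; _:=_; con; _:+_; _:*_; _:^_; Polynomial)
open import Data.List using (List; []; _∷_; map; length; filter; foldr)
open import Data.List.Properties using (map-∘)
open import Data.List.Relation.Unary.All as All using (All; all?)
open import Data.List.Membership.Propositional using (_∈_)
open import Data.Product using (_×_; _,_)
open import Data.Product.Properties using (≡-dec)
open import Data.List.Membership.DecPropositional (≡-dec _≟_ (≡-dec _≟_ _≟_)) using (_∈?_)
open import Algebra.Properties.CommutativeSemigroup +-commutativeSemigroup using (x∙yz≈y∙xz)
open import Relation.Nullary using (¬_; Dec)
open import Relation.Nullary.Decidable using (_→-dec_; map′; from-yes; from-no)
open import Relation.Binary.PropositionalEquality using (_≡_; refl; cong; sym; trans)
open Relation.Binary.PropositionalEquality.≡-Reasoning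

EliminationCondition : List Tri → Tri → Tri → Set
EliminationCondition F (s , i , k) (s′ , j , k′) =
  s ≡ s′ → k ≡ k′ → s < i → i < j → j < k → (s , i , j) ∈ F

eliminationCondition? : ∀ F f g → Dec (EliminationCondition F f g)
eliminationCondition? F (s , i , k) (s′ , j , k′) =
  (s ≟ s′) →-dec (k ≟ k′) →-dec (s <? i) →-dec (i <? j) →-dec (j <? k) →-dec ((s , i , j) ∈? F)

PEO-pairwise : List Tri → Set
PEO-pairwise F = All (λ f → All (EliminationCondition F f) F) F

PEO-pairwise⇒PEO : ∀ F → PEO-pairwise F → PEO F
PEO-pairwise⇒PEO F all s i j k s<i i<j j<k ik∈F jk∈F =
  All.lookup (All.lookup all ik∈F) jk∈F refl refl s<i i<j j<k

PEO⇒PEO-pairwise : ∀ F → PEO F → PEO-pairwise F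
PEO⇒PEO-pairwise F peo = All.tabulate λ f∈F → All.tabulate λ g∈F → elimination f∈F g∈F
  where
  elimination : ∀ {f g} → f ∈ F → g ∈ F → EliminationCondition F f g
  elimination {s , i , k} {.s , j , .k} ik∈F jk∈F refl refl s<i i<j j<k =
    peo s i j k s<i i<j j<k ik∈F jk∈F

PEO? : ∀ F → Dec (PEO F)
PEO? F = map′ (PEO-pairwise⇒PEO F) (PEO⇒PEO-pairwise F)
              (all? (λ f → all? (eliminationCondition? F f) F) F)

⟦_⟧ : List ℕ → ℕ → ℕ
⟦ [] ⟧     t = 0
⟦ c ∷ cs ⟧ t = c + t * ⟦ cs ⟧ t

addMonomial : ℕ → List ℕ → List ℕ
addMonomial 0       []       = 1 ∷ []
addMonomial 0       (c ∷ cs) = suc c ∷ cs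
addMonomial (suc e) []       = 0 ∷ addMonomial e []
addMonomial (suc e) (c ∷ cs) = c ∷ addMonomial e cs

⟦addMonomial⟧ : ∀ e cs t → ⟦ addMonomial e cs ⟧ t ≡ t ^ e + ⟦ cs ⟧ t
⟦addMonomial⟧ 0       []       t = cong suc (*-zeroʳ t)
⟦addMonomial⟧ 0       (c ∷ cs) t = refl
⟦addMonomial⟧ (suc e) []       t = begin
  t * ⟦ addMonomial e [] ⟧ t ≡⟨ cong (t *_) (⟦addMonomial⟧ e [] t) ⟩
  t * (t ^ e + 0)           ≡⟨ *-distribˡ-+ t (t ^ e) 0 ⟩
  t * t ^ e + t * 0         ≡⟨ cong (t * t ^ e +_) (*-zeroʳ t) ⟩
  t * t ^ e + 0             ∎
⟦addMonomial⟧ (suc e) (c ∷ cs) t = begin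
  c + t * ⟦ addMonomial e cs ⟧ t ≡⟨ cong (λ x → c + t * x) (⟦addMonomial⟧ e cs t) ⟩
  c + t * (t ^ e + ⟦ cs ⟧ t)     ≡⟨ cong (c +_) (*-distribˡ-+ t (t ^ e) (⟦ cs ⟧ t)) ⟩
  c + (t * t ^ e + t * ⟦ cs ⟧ t) ≡⟨ x∙yz≈y∙xz c (t * t ^ e) (t * ⟦ cs ⟧ t) ⟩
  t * t ^ e + (c + t * ⟦ cs ⟧ t) ∎

tally : List ℕ → List ℕ
tally = foldr addMonomial []

sum-powers≡⟦tally⟧ : ∀ es t → sum (map (t ^_) es) ≡ ⟦ tally es ⟧ t
sum-powers≡⟦tally⟧ []       t = refl
sum-powers≡⟦tally⟧ (e ∷ es) t = begin
  t ^ e + sum (map (t ^_) es) ≡⟨ cong (t ^ e +_) (sum-powers≡⟦tally⟧ es t) ⟩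
  t ^ e + ⟦ tally es ⟧ t      ≡⟨ sym (⟦addMonomial⟧ e (tally es) t) ⟩
  ⟦ tally (e ∷ es) ⟧ t        ∎

exponents : ℕ → List Tri → List ℕ
exponents n F = map (λ U → N n F ∸ length U) (filter cageFree? (subsets F))

genFun≡⟦tally⟧ : ∀ n F cs → tally (exponents n F) ≡ cs → ∀ t → genFun n F t ≡ ⟦ cs ⟧ t
genFun≡⟦tally⟧ n F .(tally (exponents n F)) refl t =
  trans (cong sum (map-∘ (filter cageFree? (subsets F))))
        (sum-powers≡⟦tally⟧ (exponents n F) t)

-- Its denotation is definitionally ⟦ cs ⟧ t, which lets the solver prove the statements below.
hornerPolynomial : ∀ {m} → List ℕ → Polynomial m → Polynomial m
hornerPolynomial []       x = con 0
hornerPolynomial (c ∷ cs) x = con c :+ x :* hornerPolynomial cs x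

⟦2,9,16,14,6,1⟧≡[t+1]⁴[t+2] : ∀ t → ⟦ 2 ∷ 9 ∷ 16 ∷ 14 ∷ 6 ∷ 1 ∷ [] ⟧ t ≡ (t + 1) ^ 4 * (t + 2)
⟦2,9,16,14,6,1⟧≡[t+1]⁴[t+2] = solve 1 (λ t →
  hornerPolynomial (2 ∷ 9 ∷ 16 ∷ 14 ∷ 6 ∷ 1 ∷ []) t := (t :+ con 1) :^ 4 :* (t :+ con 2)) refl

⟦4,12,13,6,1⟧≡[t+1]²[t+2]² : ∀ t → ⟦ 4 ∷ 12 ∷ 13 ∷ 6 ∷ 1 ∷ [] ⟧ t ≡ (t + 1) ^ 2 * (t + 2) ^ 2
⟦4,12,13,6,1⟧≡[t+1]²[t+2]² = solve 1 (λ t →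
  hornerPolynomial (4 ∷ 12 ∷ 13 ∷ 6 ∷ 1 ∷ []) t := (t :+ con 1) :^ 2 :* (t :+ con 2) :^ 2) refl

-- Labeling (c) fails at s , i , j , k = 1 , 3 , 4 , 5: 135 and 145 are facets, the equator 134 is not.
mainTheorem7 : PEO Δa × PEO Δb × ¬ PEO Δc
    × (∀ (t : ℕ) → genFun 5 Δa t ≡ (t + 1) ^ 4 * (t + 2))
    × (∀ (t : ℕ) → genFun 5 Δc t ≡ (t + 1) ^ 4 * (t + 2))
    × (∀ (t : ℕ) → genFun 5 Δb t ≡ (t + 1) ^ 2 * (t + 2) ^ 2)
mainTheorem7 =
  from-yes (PEO? Δa) , from-yes (PEO? Δb) , from-no (PEO? Δc) ,
  (λ t → trans (genFun≡⟦tally⟧ 5 Δa _ refl t) (⟦2,9,16,14,6,1⟧≡[t+1]⁴[t+2] t)) ,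
  (λ t → trans (genFun≡⟦tally⟧ 5 Δc _ refl t) (⟦2,9,16,14,6,1⟧≡[t+1]⁴[t+2] t)) ,
  (λ t → trans (genFun≡⟦tally⟧ 5 Δb _ refl t) (⟦4,12,13,6,1⟧≡[t+1]²[t+2]² t))
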